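{- Let $W$ be a set (of possible worlds) and let $\mathrm{ob}:\mathscr P(W)\to\mathscr P(\mathscr P(W))$ be a function satisfying the following three conditions, for all $X,Y,Z\subseteq W$: (5b) if $Y\cap X=Z\cap X$, then $Y\in\mathrm{ob}(X)$ if and only if $Z\in\mathrm{ob}(X)$; (5d) if $Y\subseteq X$, $Y\in\mathrm{ob}(X)$ and $X\subseteq Z$, then $(Z\setminus X)\cup Y\in\mathrm{ob}(Z)$; (5e) if $Y\subseteq X$, $Z\in\mathrm{ob}(X)$ and $Y\cap Z\neq\emptyset$, then $Z\in\mathrm{ob}(Y)$. Let $A,B$ be propositions whose truth sets $[\![A]\!],[\![B]\!]\subseteq W$ are mutually generic, i.e. the four sets $[\![A]\!]\cap[\![B]\!]$, $[\![A]\!]\setminus[\![B]\!]$, $[\![B]\!]\setminus[\![A]\!]$ and $W\setminus([\![A]\!]\cup[\![B]\!])$ are all nonempty. Then \[ [\![A]\!]\in\mathrm{ob}(W)\implies [\![B]\!]\in\mathrm{ob}(W\setminus[\![A]\!]). \]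
   Context: For a proposition $A$, $[\![A]\!]\subseteq W$ denotes the set of worlds in which $A$ is true; thus $[\![\top]\!]=W$ and $[\![\neg A]\!]=W\setminus[\![A]\!]$. The function $\mathrm{ob}$ assigns to each context $X\subseteq W$ the set of propositions (subsets of $W$) obligatory in that context. The conditions (5b), (5d), (5e) are Carmo and Jones' conditions 5(b), 5(d), 5(e). -}

module Defs where

open import Data.Bool using (Bool; true; false; _∧_; _∨_; not)
open import Data.Product using (Σ; _×_)
open import Relation.Binary.PropositionalEquality using (_≡_)
open import Relation.Nullary using (¬_)

Subset : Set → Set
Subset W = W → Bool

module _ {W : Set} where

  _∈ₛ_ : W → Subset W → Set
  w ∈ₛ X = X w ≡ true

  Full : Subset W
  Full _ = true

  Empty : Subset W
  Empty _ = false

  _∩_ : Subset W → Subset W → Subset W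
  (X ∩ Y) w = X w ∧ Y w

  _∪_ : Subset W → Subset W → Subset W
  (X ∪ Y) w = X w ∨ Y w

  _∖_ : Subset W → Subset W → Subset W
  (X ∖ Y) w = X w ∧ not (Y w)

  _⊆_ : Subset W → Subset W → Set
  X ⊆ Y = ∀ w → w ∈ₛ X → w ∈ₛ Y

  _≐_ : Subset W → Subset W → Set
  X ≐ Y = ∀ w → X w ≡ Y w

  Nonempty : Subset W → Set
  Nonempty X = Σ W (λ w → w ∈ₛ X)

  _≢∅ : Subset W → Set
  X ≢∅ = ¬ (X ≐ Empty)

  Cond5b : (Subset W → Subset W → Set) → Set
  Cond5b ob = ∀ X Y Z → (Y ∩ X) ≐ (Z ∩ X) →
    (ob X Y → ob X Z) × (ob X Z → ob X Y)

  Cond5d : (Subset W → Subset W → Set) → Set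
  Cond5d ob = ∀ X Y Z → Y ⊆ X → ob X Y → X ⊆ Z → ob Z ((Z ∖ X) ∪ Y)

  Cond5e : (Subset W → Subset W → Set) → Set
  Cond5e ob = ∀ X Y Z → Y ⊆ X → ob X Z → (Y ∩ Z) ≢∅ → ob Y Z

-- Let Y be the set of worlds where A and B agree. Restricting the obligation A from W to Y
-- (5e, using a world of A ∩ B) gives A ∈ ob(Y), hence A ∩ B ∈ ob(Y) since A and A ∩ B coincide
-- on Y (5b). Extending back to W (5d) yields (W ∖ Y) ∪ (A ∩ B) ∈ ob(W), which a world of B ∖ A
-- lets us restrict to W ∖ A (5e); there this proposition coincides with B (5b).
module Submission where

open import Data.Bool using (true; false)
open import Data.Product using (_,_; proj₁)
open import Relation.Binary.PropositionalEquality using (refl; trans; sym)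

open import Defs

module _ {W : Set} where

  Agree : Subset W → Subset W → Subset W
  Agree A B = (A ∩ B) ∪ (Full ∖ (A ∪ B))

  ⊆-Full : {X : Subset W} → X ⊆ Full
  ⊆-Full _ _ = refl

  Nonempty-mono : {X Y : Subset W} → X ⊆ Y → Nonempty X → Nonempty Y
  Nonempty-mono X⊆Y (w , w∈X) = w , X⊆Y w w∈X

  Nonempty⇒≢∅ : {X : Subset W} → Nonempty X → X ≢∅
  Nonempty⇒≢∅ (w , w∈X) X≐∅ with trans (sym w∈X) (X≐∅ w)
  ... | ()

  ∩⊆Agree : (A B : Subset W) → (A ∩ B) ⊆ Agree A B
  ∩⊆Agree A B w _ with A w | B w
  ∩⊆Agree A B w () | true  | false
  ∩⊆Agree A B w () | false | _
  ... | true | true = refl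

  ∩⊆Agree∩ : (A B : Subset W) → (A ∩ B) ⊆ (Agree A B ∩ A)
  ∩⊆Agree∩ A B w _ with A w | B w
  ∩⊆Agree∩ A B w () | true  | false
  ∩⊆Agree∩ A B w () | false | _
  ... | true | true = refl

  Agree-∩ : (A B : Subset W) → (A ∩ Agree A B) ≐ ((A ∩ B) ∩ Agree A B)
  Agree-∩ A B w with A w | B w
  ... | true  | true  = refl
  ... | true  | false = refl
  ... | false | _     = refl

  ∖⊆∖∩Disagree∪∩ : (A B : Subset W) → (B ∖ A) ⊆ ((Full ∖ A) ∩ ((Full ∖ Agree A B) ∪ (A ∩ B)))
  ∖⊆∖∩Disagree∪∩ A B w _ with A w | B w
  ∖⊆∖∩Disagree∪∩ A B w () | true  | true
  ∖⊆∖∩Disagree∪∩ A B w () | _     | false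
  ... | false | true = refl

  Disagree∪∩-∖ : (A B : Subset W) →
    (((Full ∖ Agree A B) ∪ (A ∩ B)) ∩ (Full ∖ A)) ≐ (B ∩ (Full ∖ A))
  Disagree∪∩-∖ A B w with A w | B w
  ... | true  | true  = refl
  ... | true  | false = refl
  ... | false | true  = refl
  ... | false | false = refl

  module _ {ob : Subset W → Subset W → Set} where

    ob-cong : Cond5b ob → {X Y Z : Subset W} → (Y ∩ X) ≐ (Z ∩ X) → ob X Y → ob X Z
    ob-cong c5b {X} {Y} {Z} Y≐Z = proj₁ (c5b X Y Z Y≐Z)

    ob-restrict : Cond5e ob → {X Y Z : Subset W} →
      Y ⊆ X → Nonempty (Y ∩ Z) → ob X Z → ob Y Z
    ob-restrict c5e {X} {Y} {Z} Y⊆X Y∩Z≠∅ obXZ = c5e X Y Z Y⊆X obXZ (Nonempty⇒≢∅ Y∩Z≠∅)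

    ob-extend-Full : Cond5d ob → {X Y : Subset W} →
      Y ⊆ X → ob X Y → ob Full ((Full ∖ X) ∪ Y)
    ob-extend-Full c5d {X} {Y} Y⊆X obXY = c5d X Y Full Y⊆X obXY ⊆-Full

theorem1 : (W : Set) (ob : Subset W → Subset W → Set) →
    Cond5b ob → Cond5d ob → Cond5e ob →
    (A B : Subset W) →
    Nonempty (A ∩ B) → Nonempty (A ∖ B) → Nonempty (B ∖ A) →
    Nonempty (Full ∖ (A ∪ B)) →
    ob Full A → ob (Full ∖ A) B
theorem1 W ob c5b c5d c5e A B A∩B≠∅ _ B∖A≠∅ _ obA =
  ob-cong c5b (Disagree∪∩-∖ A B)
    (ob-restrict c5e ⊆-Full (Nonempty-mono (∖⊆∖∩Disagree∪∩ A B) B∖A≠∅) obFull-Disagree∪∩)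
  where
  obAgree-∩ : ob (Agree A B) (A ∩ B)
  obAgree-∩ = ob-cong c5b (Agree-∩ A B)
    (ob-restrict c5e ⊆-Full (Nonempty-mono (∩⊆Agree∩ A B) A∩B≠∅) obA)

  obFull-Disagree∪∩ : ob Full ((Full ∖ Agree A B) ∪ (A ∩ B))
  obFull-Disagree∪∩ = ob-extend-Full c5d (∩⊆Agree A B) obAgree-∩
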